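{- Let $n\ge 1$ and $S=\{s_1,\dots,s_k\}\subseteq\{1,\dots,n-1\}$. Then \[ c_n^S = n! - \sum_{i\in S} i!\, c_{n-i}^{\{1,\dots,n-i-1\}\cap\{s_1-i,\dots,s_k-i\}}. \]
   Context: A permutation $\sigma$ of $\{1,\dots,n\}$ fixes a prefix of size $j$ if $\sigma(\{1,\dots,j\})=\{1,\dots,j\}$. For $S\subseteq\{1,\dots,n-1\}$, an $S$-connected permutation of size $n$ is a permutation of $\{1,\dots,n\}$ that fixes no prefix of size $j$ for any $j\in S$; $c_n^S$ denotes the number of $S$-connected permutations of size $n$ (so $c_m^{\emptyset}=m!$). -}

module Defs where

open import Data.Nat using (ℕ; zero; suc; _+_; _*_; _∸_; _<_; _≤_; _<?_; _≤?_; _!)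
open import Data.Nat.ListAction using (sum)

open import Data.Bool using (Bool; true; false)
open import Data.Fin using (Fin; toℕ)
open import Data.Fin.Properties using (_≟_)
open import Data.List using (List; []; _∷_; map; concatMap; filter; length; upTo; allFin; zip)
open import Data.List.Relation.Unary.All using (All; all?)
open import Data.List.Relation.Unary.Any using (Any; any?)
open import Data.List.Relation.Unary.AllPairs using (AllPairs; allPairs?)
open import Data.Product using (_×_; _,_; proj₁; proj₂)
open import Relation.Nullary using (¬_; Dec; yes; no; ¬?)
open import Relation.Nullary.Decidable using (_×-dec_; _→-dec_)
open import Relation.Binary.PropositionalEquality using (_≡_)
open import Data.Bool.Properties using () renaming (_≟_ to _≟ᵇ_)

-- A map σ : {1..n} → {1..n} is represented as the list [σ(1), …, σ(n)]
-- of its values; the element i of {1..n} is encoded as (i-1) : Fin n.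

words : (n m : ℕ) → List (List (Fin n))
words n zero    = [] ∷ []
words n (suc m) = concatMap (λ w → map (_∷ w) (allFin n)) (words n m)

perms : (n : ℕ) → List (List (Fin n))
perms n = filter (allPairs? (λ x y → ¬? (x ≟ y))) (words n n)

-- The graph of σ: pairs (position k (0-based), value σ(k+1)-1).
graph : ∀ {n} → List (Fin n) → List (ℕ × ℕ)
graph σ = zip (upTo (length σ)) (map toℕ σ)

-- σ fixes a prefix of size j:  σ({1..j}) = {1..j}, i.e.
--   every k ≤ j has σ(k) ≤ j, and every m ≤ j equals σ(k) for some k ≤ j.
-- (0-based: positions/values < j.)
FixesPrefix : ∀ {n} → List (Fin n) → ℕ → Set
FixesPrefix σ j =
  All (λ p → proj₁ p < j → proj₂ p < j) (graph σ) ×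
  All (λ m → Any (λ p → proj₁ p < j × proj₂ p ≡ m) (graph σ)) (upTo j)

fixesPrefix? : ∀ {n} (σ : List (Fin n)) (j : ℕ) → Dec (FixesPrefix σ j)
fixesPrefix? σ j =
  all? (λ p → (proj₁ p <? j) →-dec (proj₂ p <? j)) (graph σ) ×-dec
  all? (λ m → any? (λ p → (proj₁ p <? j) ×-dec (proj₂ p Data.Nat.≟ m)) (graph σ)) (upTo j)
  where import Data.Nat

-- A subset S of the positive integers is given by its characteristic
-- function S : ℕ → Bool (j ∈ S iff S j ≡ true).
-- σ (of size n) is S-connected iff it fixes no prefix of size j for any
-- j ∈ S ∩ {1..n-1}.
Connected : ∀ {n} → (ℕ → Bool) → List (Fin n) → Set
Connected {n} S σ =
  All (λ j → 1 ≤ j → S j ≡ true → ¬ FixesPrefix σ j) (upTo n)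

connected? : ∀ {n} (S : ℕ → Bool) (σ : List (Fin n)) → Dec (Connected S σ)
connected? {n} S σ =
  all? (λ j → (1 ≤? j) →-dec ((S j ≟ᵇ true) →-dec ¬? (fixesPrefix? σ j))) (upTo n)

-- c n S = c_n^{S ∩ {1..n-1}} : number of S-connected permutations of size n.
c : ℕ → (ℕ → Bool) → ℕ
c n S = length (filter (connected? S) (perms n))

-- The shifted set {s - i : s ∈ S} (only its positive part matters, and
-- c intersects with {1..m-1} automatically).
shift : ℕ → (ℕ → Bool) → (ℕ → Bool)
shift i S j = S (j + i)

sumOver : ℕ → (ℕ → Bool) → (ℕ → ℕ) → ℕ
sumOver n S f = sum (map (λ i → f i) (filter (λ i → (1 ≤? i) ×-dec (S i ≟ᵇ true)) (upTo n)))

{-# OPTIONS --safe #-}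
-- A permutation of size n that is not S-connected fixes a prefix of some size
-- in S; let i be the largest one. Cutting it after position i gives a
-- permutation of size i and, with values lowered by i, a permutation of size
-- n - i, and maximality of i says exactly that the latter is connected with
-- respect to S shifted by i. Gluing is inverse to cutting, so i! c_{n-i}^{S-i}
-- permutations have largest fixed S-prefix i, and summing over i ∈ S together
-- with the S-connected ones accounts for all n! permutations.
-- Permutations are handled as injective lists of naturals, for which fixing
-- the prefix of size j just means that the first j values are below j.
module Submission where

open import Defs
open import Data.Bool using (Bool; true)
open import Data.Bool.Properties using () renaming (_≟_ to _≟ᵇ_)
open import Data.Empty using (⊥-elim)
open import Data.Fin using (Fin; toℕ; fromℕ<)
open import Data.Fin.Properties using (toℕ-injective; toℕ<n; toℕ-fromℕ<) renaming (_≟_ to _≟ᶠ_)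
open import Data.List
  using (List; []; _∷_; _++_; map; filter; length; take; drop; upTo; applyUpTo; allFin; zip; cartesianProduct)
open import Data.List.Properties
  using (length-map; length-++; length-take; length-drop; length-upTo; map-∘; map-cong; map-cong-local; map-id-local;
         map-injective; take-map; take++drop≡id; ++-cancelˡ; ∷-injectiveˡ; ∷-injectiveʳ)
open import Data.List.Membership.Propositional using (_∈_; find; lose)
open import Data.List.Membership.Propositional.Properties
open import Data.List.Relation.Binary.Disjoint.Propositional using (Disjoint)
open import Data.List.Relation.Binary.Subset.Propositional using (_⊆_)
open import Data.List.Relation.Unary.All as All using (All; []; _∷_)
import Data.List.Relation.Unary.All.Properties as All
open import Data.List.Relation.Unary.AllPairs as AllPairs using ([]; _∷_)
import Data.List.Relation.Unary.AllPairs.Properties as AllPairs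
open import Data.List.Relation.Unary.Any using (Any; here; there)
import Data.List.Relation.Unary.Any.Properties as Any
open import Data.List.Relation.Unary.Unique.Propositional using (Unique)
import Data.List.Relation.Unary.Unique.Propositional.Properties as Unique
open import Data.Nat
  using (ℕ; zero; suc; pred; z<s; _+_; _*_; _∸_; _≤_; _<_; z≤n; s≤s; s≤s⁻¹; _<?_; _≤?_; _!)
  renaming (_≟_ to _≟ⁿ_)
open import Data.Nat.ListAction using (sum)
open import Data.List.Membership.DecPropositional _≟ⁿ_ using (_∈?_)
open import Data.Nat.Properties
open import Algebra.Properties.CommutativeSemigroup +-commutativeSemigroup using (interchange)
open import Data.Product using (_×_; _,_; proj₁; proj₂; ∃)
open import Data.Sum using (inj₁; inj₂)
open import Function using (id; _∘_; _⇔_; mk⇔; Equivalence; case_of_)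
open import Relation.Binary.Definitions using (tri<; tri≈; tri>)
open import Relation.Binary.PropositionalEquality
open import Relation.Nullary using (¬_; Dec; yes; no; ¬?)
open import Relation.Nullary.Decidable using (_×-dec_; _→-dec_; decidable-stable)
open import Relation.Unary using (Decidable)

private
  variable
    A B : Set

InjectiveOn : (A → B) → List A → Set
InjectiveOn f xs = ∀ {x y} → x ∈ xs → y ∈ xs → f x ≡ f y → x ≡ y

Unique-map⁺ : {f : A → B} {xs : List A} → InjectiveOn f xs → Unique xs → Unique (map f xs)
Unique-map⁺ {xs = []} _ [] = []
Unique-map⁺ {xs = x ∷ xs} inj (x∉xs ∷ u) =
  All.map⁺ (All.tabulate λ y∈xs fx≡fy → All.lookup x∉xs y∈xs (inj (here refl) (there y∈xs) fx≡fy))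
  ∷ Unique-map⁺ (λ p q → inj (there p) (there q)) u

Unique-⊆⇒length-≤ : {xs ys : List A} → Unique xs → xs ⊆ ys → length xs ≤ length ys
Unique-⊆⇒length-≤ {xs = []} _ _ = z≤n
Unique-⊆⇒length-≤ {xs = x ∷ xs} (x∉xs ∷ u) xs⊆ys
  with ys₁ , ys₂ , refl ← ∈-∃++ (xs⊆ys (here refl)) = begin
    suc (length xs)           ≤⟨ s≤s (Unique-⊆⇒length-≤ u xs⊆ys₁++ys₂) ⟩
    suc (length (ys₁ ++ ys₂)) ≡⟨ cong suc (length-++ ys₁) ⟩
    suc (length ys₁ + length ys₂) ≡⟨ +-suc (length ys₁) (length ys₂) ⟨
    length ys₁ + length (x ∷ ys₂) ≡⟨ length-++ ys₁ ⟨
    length (ys₁ ++ x ∷ ys₂) ∎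
  where
  open ≤-Reasoning
  xs⊆ys₁++ys₂ : xs ⊆ ys₁ ++ ys₂
  xs⊆ys₁++ys₂ y∈xs with ∈-++⁻ ys₁ (xs⊆ys (there y∈xs))
  ... | inj₁ y∈ys₁ = ∈-++⁺ˡ y∈ys₁
  ... | inj₂ (here refl) = ⊥-elim (All.lookup x∉xs y∈xs refl)
  ... | inj₂ (there y∈ys₂) = ∈-++⁺ʳ ys₁ y∈ys₂

length-≡-by-bijection : {xs : List A} {ys : List B} (f : A → B) → Unique xs → Unique ys →
  InjectiveOn f xs → (∀ {x} → x ∈ xs → f x ∈ ys) →
  (∀ {y} → y ∈ ys → ∃ λ x → x ∈ xs × f x ≡ y) →
  length xs ≡ length ys
length-≡-by-bijection {xs = xs} {ys} f uxs uys inj into onto = begin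
  length xs       ≡⟨ length-map f xs ⟨
  length (map f xs) ≡⟨ ≤-antisym (Unique-⊆⇒length-≤ (Unique-map⁺ inj uxs) image⊆ys)
                                 (Unique-⊆⇒length-≤ uys ys⊆image) ⟩
  length ys       ∎
  where
  open ≡-Reasoning
  image⊆ys : map f xs ⊆ ys
  image⊆ys y∈ with x , x∈xs , refl ← ∈-map⁻ f y∈ = into x∈xs
  ys⊆image : ys ⊆ map f xs
  ys⊆image y∈ys with x , x∈xs , refl ← onto y∈ys = ∈-map⁺ f x∈xs

Unique-++⇒Disjoint : (xs : List A) {ys : List A} → Unique (xs ++ ys) → Disjoint xs ys
Unique-++⇒Disjoint (x ∷ xs) (x∉ ∷ _) (here refl , x∈ys) = All.lookup x∉ (∈-++⁺ʳ xs x∈ys) refl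
Unique-++⇒Disjoint (_ ∷ xs) (_ ∷ u) (there y∈xs , y∈ys) = Unique-++⇒Disjoint xs u (y∈xs , y∈ys)

length-cartesianProduct : (xs : List A) (ys : List B) →
  length (cartesianProduct xs ys) ≡ length xs * length ys
length-cartesianProduct [] ys = refl
length-cartesianProduct (x ∷ xs) ys = begin
  length (map (x ,_) ys ++ cartesianProduct xs ys)
    ≡⟨ length-++ (map (x ,_) ys) ⟩
  length (map (x ,_) ys) + length (cartesianProduct xs ys)
    ≡⟨ cong₂ _+_ (length-map _ ys) (length-cartesianProduct xs ys) ⟩
  length ys + length xs * length ys ∎
  where open ≡-Reasoning

indicator : {P : Set} → Dec P → ℕ
indicator (yes _) = 1
indicator (no _)  = 0

indicator-yes : {P : Set} (P? : Dec P) → P → indicator P? ≡ 1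
indicator-yes (yes _) _ = refl
indicator-yes (no ¬p) p = ⊥-elim (¬p p)

indicator-no : {P : Set} (P? : Dec P) → ¬ P → indicator P? ≡ 0
indicator-no (yes p) ¬p = ⊥-elim (¬p p)
indicator-no (no _)  _  = refl

length-filter-∷ : {P : A → Set} (P? : Decidable P) (x : A) (xs : List A) →
  length (filter P? (x ∷ xs)) ≡ indicator (P? x) + length (filter P? xs)
length-filter-∷ P? x xs with P? x
... | yes _ = refl
... | no _  = refl

length-filter-+-length-filter-¬ : {P : A → Set} (P? : Decidable P) (xs : List A) →
  length (filter P? xs) + length (filter (¬? ∘ P?) xs) ≡ length xs
length-filter-+-length-filter-¬ P? [] = refl
length-filter-+-length-filter-¬ P? (x ∷ xs) with P? x
... | yes _ = cong suc (length-filter-+-length-filter-¬ P? xs)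
... | no _  = trans (+-suc _ _) (cong suc (length-filter-+-length-filter-¬ P? xs))

length-filter-map : {P : A → Set} {Q : B → Set} (P? : Decidable P) (Q? : Decidable Q) (f : A → B)
  (xs : List A) → (∀ {x} → x ∈ xs → P x ⇔ Q (f x)) →
  length (filter P? xs) ≡ length (filter Q? (map f xs))
length-filter-map P? Q? f [] _ = refl
length-filter-map P? Q? f (x ∷ xs) P⇔Q with P? x | Q? (f x)
... | yes _  | yes _  = cong suc (length-filter-map P? Q? f xs (P⇔Q ∘ there))
... | yes p  | no ¬q  = ⊥-elim (¬q (Equivalence.to (P⇔Q (here refl)) p))
... | no ¬p  | yes q  = ⊥-elim (¬p (Equivalence.from (P⇔Q (here refl)) q))
... | no _   | no _   = length-filter-map P? Q? f xs (P⇔Q ∘ there)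

sum-map-≡0 : (f : A → ℕ) (xs : List A) → (∀ {x} → x ∈ xs → f x ≡ 0) → sum (map f xs) ≡ 0
sum-map-≡0 f [] _ = refl
sum-map-≡0 f (x ∷ xs) f≡0 = cong₂ _+_ (f≡0 (here refl)) (sum-map-≡0 f xs (f≡0 ∘ there))

sum-map-+ : (f g : A → ℕ) (xs : List A) → sum (map (λ x → f x + g x) xs) ≡ sum (map f xs) + sum (map g xs)
sum-map-+ f g [] = refl
sum-map-+ f g (x ∷ xs) = trans (cong (f x + g x +_) (sum-map-+ f g xs)) (interchange (f x) (g x) _ _)

sum-indicator : {M : B → Set} {Q : Set} (M? : Decidable M) (Q? : Dec Q) {is : List B} → Unique is →
  (Q → ∃ λ i → i ∈ is × M i) → (∀ {i} → i ∈ is → M i → Q) →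
  (∀ {i j} → i ∈ is → j ∈ is → M i → M j → i ≡ j) →
  sum (map (indicator ∘ M?) is) ≡ indicator Q?
sum-indicator M? Q? {[]} _ witness _ _ = sym (indicator-no Q? λ q → case witness q of λ ())
sum-indicator {M = M} {Q} M? Q? {i ∷ is} (i∉is ∷ u) witness sound unique with M? i
... | yes mi = begin
  suc (sum (map (indicator ∘ M?) is)) ≡⟨ cong suc (sum-map-≡0 _ is λ j∈is → indicator-no (M? _) λ mj →
                                           All.lookup i∉is j∈is (unique (here refl) (there j∈is) mi mj)) ⟩
  1                                   ≡⟨ indicator-yes Q? (sound (here refl) mi) ⟨
  indicator Q?                        ∎
  where open ≡-Reasoning
... | no ¬mi = sum-indicator M? Q? u witness′ (sound ∘ there) λ p q → unique (there p) (there q)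
  where
  witness′ : Q → ∃ λ j → j ∈ is × M j
  witness′ q with witness q
  ... | _ , here refl , mi = ⊥-elim (¬mi mi)
  ... | j , there j∈is , mj = j , j∈is , mj

sum-length-filter : {M : B → A → Set} (M? : ∀ i → Decidable (M i)) {Q : A → Set} (Q? : Decidable Q)
  {is : List B} → Unique is → (xs : List A) →
  (∀ {x} → x ∈ xs → Q x → ∃ λ i → i ∈ is × M i x) →
  (∀ {x i} → x ∈ xs → i ∈ is → M i x → Q x) →
  (∀ {x i j} → x ∈ xs → i ∈ is → j ∈ is → M i x → M j x → i ≡ j) →
  sum (map (λ i → length (filter (M? i) xs)) is) ≡ length (filter Q? xs)
sum-length-filter M? Q? {is} _ [] _ _ _ = sum-map-≡0 _ is λ _ → refl
sum-length-filter M? Q? {is} u (x ∷ xs) witness sound unique = begin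
  sum (map (λ i → length (filter (M? i) (x ∷ xs))) is)
    ≡⟨ cong sum (map-cong (λ i → length-filter-∷ (M? i) x xs) is) ⟩
  sum (map (λ i → indicator (M? i x) + length (filter (M? i) xs)) is)
    ≡⟨ sum-map-+ (λ i → indicator (M? i x)) (λ i → length (filter (M? i) xs)) is ⟩
  sum (map (λ i → indicator (M? i x)) is) + sum (map (λ i → length (filter (M? i) xs)) is)
    ≡⟨ cong₂ _+_ (sum-indicator (λ i → M? i x) (Q? x) u (witness (here refl)) (sound (here refl)) (unique (here refl)))
                 (sum-length-filter M? Q? u xs (witness ∘ there) (sound ∘ there) (unique ∘ there)) ⟩
  indicator (Q? x) + length (filter Q? xs)
    ≡⟨ length-filter-∷ Q? x xs ⟨
  length (filter Q? (x ∷ xs)) ∎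
  where open ≡-Reasoning

pigeonhole : {j m : ℕ} (xs : List ℕ) → Unique xs → All (_< j) xs → length xs ≡ j → m < j → m ∈ xs
pigeonhole {j} {m} xs u xs<j refl m<j with m ∈? xs
... | yes m∈xs = m∈xs
... | no m∉xs = ⊥-elim (<⇒≱ (s≤s ≤-refl) (begin
  suc (length xs)   ≤⟨ Unique-⊆⇒length-≤ (All.tabulate (λ m∈ m≡ → m∉xs (subst (_∈ xs) (sym m≡) m∈)) ∷ u)
                                          m∷xs⊆ ⟩
  length (upTo j)   ≡⟨ length-upTo j ⟩
  length xs         ∎))
  where
  open ≤-Reasoning
  m∷xs⊆ : m ∷ xs ⊆ upTo (length xs)
  m∷xs⊆ (here refl) = ∈-upTo⁺ m<j
  m∷xs⊆ (there x∈xs) = ∈-upTo⁺ (All.lookup xs<j x∈xs)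

largest-below : {Q : ℕ → Set} → (∀ j → Dec (Q j)) → {m j : ℕ} → j < m → Q j →
  ∃ λ i → i < m × Q i × (∀ {k} → i < k → k < m → ¬ Q k)
largest-below Q? {suc m} {j} j<1+m qj with Q? m
... | yes qm = m , ≤-refl , qm , λ m<k k<1+m → ⊥-elim (<⇒≱ m<k (s≤s⁻¹ k<1+m))
... | no ¬qm with m≤n⇒m<n∨m≡n (s≤s⁻¹ j<1+m)
...   | inj₂ refl = ⊥-elim (¬qm qj)
...   | inj₁ j<m with i , i<m , qi , above ← largest-below Q? j<m qj =
  i , m<n⇒m<1+n i<m , qi , λ i<k k<1+m → case m≤n⇒m<n∨m≡n (s≤s⁻¹ k<1+m) of λ where
    (inj₁ k<m) → above i<k k<m
    (inj₂ refl) → ¬qm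

module _ {n : ℕ} where

  private
    prepend : List (Fin n) → List (List (Fin n))
    prepend w = map (_∷ w) (allFin n)

  ∈-words⁻ : ∀ m {w} → w ∈ words n m → length w ≡ m
  ∈-words⁻ zero (here refl) = refl
  ∈-words⁻ (suc m) w∈
    with ws , w∈ws , ws∈ ← ∈-concat⁻′ (map prepend (words n m)) w∈
    with w′ , w′∈ , refl ← ∈-map⁻ prepend ws∈
    with _ , _ , refl ← ∈-map⁻ (_∷ w′) w∈ws = cong suc (∈-words⁻ m w′∈)

  ∈-words⁺ : ∀ m (w : List (Fin n)) → length w ≡ m → w ∈ words n m
  ∈-words⁺ zero [] refl = here refl
  ∈-words⁺ (suc m) (a ∷ w) refl =
    ∈-concat⁺′ (∈-map⁺ (_∷ w) (∈-allFin a)) (∈-map⁺ prepend (∈-words⁺ m w refl))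

  words-unique : ∀ m → Unique (words n m)
  words-unique zero = [] ∷ []
  words-unique (suc m) = Unique.concat⁺
    (All.map⁺ (All.tabulate λ _ → Unique.map⁺ ∷-injectiveˡ (Unique.allFin⁺ n)))
    (AllPairs.map⁺ (AllPairs.map prepend-disjoint (words-unique m)))
    where
    prepend-disjoint : ∀ {w w′} → w ≢ w′ → Disjoint (prepend w) (prepend w′)
    prepend-disjoint w≢w′ (v∈ , v∈′)
      with _ , _ , refl ← ∈-map⁻ _ v∈
      with _ , _ , eq ← ∈-map⁻ _ v∈′ = w≢w′ (∷-injectiveʳ eq)

  ∈-perms⁻ : ∀ {σ} → σ ∈ perms n → length σ ≡ n × Unique σ
  ∈-perms⁻ σ∈ with w∈ , u ← ∈-filter⁻ (AllPairs.allPairs? (λ x y → ¬? (x ≟ᶠ y))) σ∈ =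
    ∈-words⁻ n w∈ , u

  ∈-perms⁺ : ∀ {σ} → length σ ≡ n → Unique σ → σ ∈ perms n
  ∈-perms⁺ {σ} len u = ∈-filter⁺ (AllPairs.allPairs? (λ x y → ¬? (x ≟ᶠ y))) (∈-words⁺ n σ len) u

IsPermutation : ℕ → List ℕ → Set
IsPermutation n l = length l ≡ n × All (_< n) l × Unique l

permutations : ℕ → List (List ℕ)
permutations n = map (map toℕ) (perms n)

permutations-unique : ∀ n → Unique (permutations n)
permutations-unique n = Unique.map⁺ (map-injective toℕ-injective) (Unique.filter⁺ _ (words-unique n))

perm⇒IsPermutation : ∀ {n} {σ : List (Fin n)} → σ ∈ perms n → IsPermutation n (map toℕ σ)
perm⇒IsPermutation {σ = σ} σ∈ with len , u ← ∈-perms⁻ σ∈ =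
  trans (length-map toℕ σ) len , All.map⁺ (All.tabulate λ {x} _ → toℕ<n x) , Unique.map⁺ toℕ-injective u

∈-permutations⁻ : ∀ {n l} → l ∈ permutations n → IsPermutation n l
∈-permutations⁻ l∈ with _ , σ∈ , refl ← ∈-map⁻ (map toℕ) l∈ = perm⇒IsPermutation σ∈

∈-permutations⁺ : ∀ {n l} → IsPermutation n l → l ∈ permutations n
∈-permutations⁺ {n} {l} (len , l<n , u) = subst (_∈ permutations n) toℕ-σ (∈-map⁺ (map toℕ) σ∈)
  where
  fromℕ<s : ∀ {xs} → All (_< n) xs → List (Fin n)
  fromℕ<s [] = []
  fromℕ<s (x<n ∷ xs<n) = fromℕ< x<n ∷ fromℕ<s xs<n
  toℕ-fromℕ<s : ∀ {xs} (xs<n : All (_< n) xs) → map toℕ (fromℕ<s xs<n) ≡ xs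
  toℕ-fromℕ<s [] = refl
  toℕ-fromℕ<s (x<n ∷ xs<n) = cong₂ _∷_ (toℕ-fromℕ< x<n) (toℕ-fromℕ<s xs<n)
  σ : List (Fin n)
  σ = fromℕ<s l<n
  toℕ-σ : map toℕ σ ≡ l
  toℕ-σ = toℕ-fromℕ<s l<n
  σ∈ : σ ∈ perms n
  σ∈ = ∈-perms⁺ (trans (sym (length-map toℕ σ)) (trans (cong length toℕ-σ) len))
                (Unique.map⁻ (subst Unique (sym toℕ-σ) u))

punchInℕ : ℕ → ℕ → ℕ
punchInℕ v x with x <? v
... | yes _ = x
... | no _  = suc x

punchOutℕ : ℕ → ℕ → ℕ
punchOutℕ v x with x <? v
... | yes _ = x
... | no _  = pred x

punchInℕᵥ≢v : ∀ v x → punchInℕ v x ≢ v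
punchInℕᵥ≢v v x with x <? v
... | yes x<v = <⇒≢ x<v
... | no x≮v  = λ { refl → x≮v ≤-refl }

punchInℕ-< : ∀ {n v x} → v < suc n → x < n → punchInℕ v x < suc n
punchInℕ-< {v = v} {x} _ x<n with x <? v
... | yes _ = m<n⇒m<1+n x<n
... | no _  = s≤s x<n

punchOutℕ-< : ∀ {n v x} → v < suc n → x < suc n → x ≢ v → punchOutℕ v x < n
punchOutℕ-< {v = v} {x} v<1+n x<1+n x≢v with x <? v
... | yes x<v = <-≤-trans x<v (s≤s⁻¹ v<1+n)
... | no x≮v with x
...   | zero  = ⊥-elim (x≮v (≤∧≢⇒< z≤n x≢v))
...   | suc _ = s≤s⁻¹ x<1+n

punchInℕ-punchOutℕ : ∀ {v x} → x ≢ v → punchInℕ v (punchOutℕ v x) ≡ x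
punchInℕ-punchOutℕ {v} {x} x≢v with x <? v
... | yes x<v with x <? v
...   | yes _  = refl
...   | no x≮v = ⊥-elim (x≮v x<v)
punchInℕ-punchOutℕ {v} {zero} x≢v | no x≮v = ⊥-elim (x≮v (≤∧≢⇒< z≤n x≢v))
punchInℕ-punchOutℕ {v} {suc x} x≢v | no x≮v with x <? v
... | yes x<v = ⊥-elim (x≢v (≤-antisym x<v (≮⇒≥ x≮v)))
... | no _    = refl

punchInℕ-injective : ∀ v {x y} → punchInℕ v x ≡ punchInℕ v y → x ≡ y
punchInℕ-injective v {x} {y} eq with x <? v | y <? v
... | yes _   | yes _   = eq
... | no _    | no _    = suc-injective eq
... | yes x<v | no y≮v  = ⊥-elim (y≮v (≤-trans (n≤1+n _) (subst (_< v) eq x<v)))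
... | no x≮v  | yes y<v = ⊥-elim (x≮v (≤-trans (n≤1+n _) (subst (_< v) (sym eq) y<v)))

map-punchInℕ-punchOutℕ : ∀ {v} {xs : List ℕ} → All (v ≢_) xs → map (punchInℕ v) (map (punchOutℕ v) xs) ≡ xs
map-punchInℕ-punchOutℕ {xs = xs} v∉xs =
  trans (sym (map-∘ xs)) (map-id-local (All.map (λ v≢x → punchInℕ-punchOutℕ (v≢x ∘ sym)) v∉xs))

IsPermutation-punchIn : ∀ {n v w} → v < suc n → IsPermutation n w →
  IsPermutation (suc n) (v ∷ map (punchInℕ v) w)
IsPermutation-punchIn {v = v} {w} v<1+n (len , w<n , u) =
  cong suc (trans (length-map _ w) len) ,
  v<1+n ∷ All.map⁺ (All.map (punchInℕ-< v<1+n) w<n) ,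
  All.map⁺ (All.tabulate λ {x} _ v≡ → punchInℕᵥ≢v v x (sym v≡)) ∷ Unique.map⁺ (punchInℕ-injective v) u

IsPermutation-punchOut : ∀ {n v t} → IsPermutation (suc n) (v ∷ t) → IsPermutation n (map (punchOutℕ v) t)
IsPermutation-punchOut {v = v} {t} (len , v<1+n ∷ t<1+n , v∉t ∷ u) =
  trans (length-map _ t) (suc-injective len) ,
  All.map⁺ (All.zipWith (λ (x<1+n , v≢x) → punchOutℕ-< v<1+n x<1+n (v≢x ∘ sym)) (t<1+n , v∉t)) ,
  Unique-map⁺ punchOut-injectiveOn u
  where
  punchOut-injectiveOn : InjectiveOn (punchOutℕ v) t
  punchOut-injectiveOn {x} {y} x∈t y∈t eq = begin
    x                             ≡⟨ punchInℕ-punchOutℕ (All.lookup v∉t x∈t ∘ sym) ⟨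
    punchInℕ v (punchOutℕ v x)    ≡⟨ cong (punchInℕ v) eq ⟩
    punchInℕ v (punchOutℕ v y)    ≡⟨ punchInℕ-punchOutℕ (All.lookup v∉t y∈t ∘ sym) ⟩
    y                             ∎
    where open ≡-Reasoning

length-permutations : ∀ n → length (permutations n) ≡ n !
length-permutations zero = refl
length-permutations (suc n) = begin
  length (permutations (suc n))
    ≡⟨ length-≡-by-bijection cons (Unique.cartesianProduct⁺ (Unique.upTo⁺ (suc n)) (permutations-unique n))
                             (permutations-unique (suc n)) cons-injective cons-∈ cons-surjective ⟨
  length (cartesianProduct (upTo (suc n)) (permutations n))
    ≡⟨ length-cartesianProduct (upTo (suc n)) (permutations n) ⟩
  length (upTo (suc n)) * length (permutations n)
    ≡⟨ cong₂ _*_ (length-upTo (suc n)) (length-permutations n) ⟩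
  suc n * n ! ∎
  where
  open ≡-Reasoning
  cons : ℕ × List ℕ → List ℕ
  cons (v , w) = v ∷ map (punchInℕ v) w
  pairs : List (ℕ × List ℕ)
  pairs = cartesianProduct (upTo (suc n)) (permutations n)
  cons-injective : InjectiveOn cons pairs
  cons-injective {v , w} _ _ eq with refl ← ∷-injectiveˡ eq =
    cong (v ,_) (map-injective (punchInℕ-injective v) (∷-injectiveʳ eq))
  cons-∈ : ∀ {p} → p ∈ pairs → cons p ∈ permutations (suc n)
  cons-∈ p∈ with v∈ , w∈ ← ∈-cartesianProduct⁻ (upTo (suc n)) (permutations n) p∈ =
    ∈-permutations⁺ (IsPermutation-punchIn (∈-upTo⁻ v∈) (∈-permutations⁻ w∈))
  cons-surjective : ∀ {l} → l ∈ permutations (suc n) → ∃ λ p → p ∈ pairs × cons p ≡ l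
  cons-surjective {l} l∈ with ∈-permutations⁻ l∈
  cons-surjective {v ∷ t} l∈ | perm@(_ , v<1+n ∷ _ , v∉t ∷ _) =
    (v , map (punchOutℕ v) t) ,
    ∈-cartesianProduct⁺ (∈-upTo⁺ v<1+n) (∈-permutations⁺ (IsPermutation-punchOut perm)) ,
    cong (v ∷_) (map-punchInℕ-punchOutℕ v∉t)

FixesPrefixℕ : List ℕ → ℕ → Set
FixesPrefixℕ l j = All (_< j) (take j l)

fixesPrefixℕ? : ∀ l j → Dec (FixesPrefixℕ l j)
fixesPrefixℕ? l j = All.all? (_<? j) (take j l)

FixesPrefixOfGraph : List (ℕ × ℕ) → ℕ → Set
FixesPrefixOfGraph gr j =
  All (λ p → proj₁ p < j → proj₂ p < j) gr ×
  All (λ m → Any (λ p → proj₁ p < j × proj₂ p ≡ m) gr) (upTo j)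

graphWith : (ℕ → ℕ) → List ℕ → List (ℕ × ℕ)
graphWith f l = zip (applyUpTo f (length l)) l

graphWith-take-drop : ∀ f j l → graphWith f l ≡ graphWith f (take j l) ++ graphWith (f ∘ (j +_)) (drop j l)
graphWith-take-drop f zero l = refl
graphWith-take-drop f (suc j) [] = refl
graphWith-take-drop f (suc j) (x ∷ l) = cong ((f 0 , x) ∷_) (graphWith-take-drop (f ∘ suc) j l)

map-proj₂-graphWith : ∀ f l → map proj₂ (graphWith f l) ≡ l
map-proj₂-graphWith f [] = refl
map-proj₂-graphWith f (x ∷ l) = cong (x ∷_) (map-proj₂-graphWith (f ∘ suc) l)

All-proj₁-graphWith : ∀ {P : ℕ → Set} f l → (∀ {i} → i < length l → P (f i)) →
  All (P ∘ proj₁) (graphWith f l)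
All-proj₁-graphWith f [] _ = []
All-proj₁-graphWith f (x ∷ l) Pf = Pf z<s ∷ All-proj₁-graphWith (f ∘ suc) l (Pf ∘ s≤s)

length-take-≤ : ∀ j (l : List A) → length (take j l) ≤ j
length-take-≤ j l = subst (_≤ j) (sym (length-take j l)) (m⊓n≤m j (length l))

FixesPrefixOfGraph⇒FixesPrefixℕ : ∀ l j → FixesPrefixOfGraph (graphWith id l) j → FixesPrefixℕ l j
FixesPrefixOfGraph⇒FixesPrefixℕ l j (prefix↦prefix , _) =
  subst (All (_< j)) (map-proj₂-graphWith id (take j l))
        (All.map⁺ (All.zipWith (λ (↦prefix , k<j) → ↦prefix k<j) (onTake , positions<j)))
  where
  onTake : All (λ p → proj₁ p < j → proj₂ p < j) (graphWith id (take j l))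
  onTake = All.++⁻ˡ (graphWith id (take j l)) (subst (All _) (graphWith-take-drop id j l) prefix↦prefix)
  positions<j : All ((_< j) ∘ proj₁) (graphWith id (take j l))
  positions<j = All-proj₁-graphWith id (take j l) λ i< → <-≤-trans i< (length-take-≤ j l)

-- For an injective list, mapping the first j positions into {0, …, j-1} forces
-- every value below j to be hit, by pigeonhole.
FixesPrefixℕ⇒FixesPrefixOfGraph : ∀ l j → Unique l → j ≤ length l → FixesPrefixℕ l j →
  FixesPrefixOfGraph (graphWith id l) j
FixesPrefixℕ⇒FixesPrefixOfGraph l j u j≤l fixes rewrite graphWith-take-drop id j l =
  All.++⁺ (All.map (λ v<j _ → v<j) values<j) (All.map (λ j≤k k<j → ⊥-elim (<⇒≱ k<j j≤k)) positions≥j) ,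
  All.tabulate hit
  where
  values<j : All ((_< j) ∘ proj₂) (graphWith id (take j l))
  values<j = All.map⁻ (subst (All (_< j)) (sym (map-proj₂-graphWith id (take j l))) fixes)
  positions<j : All ((_< j) ∘ proj₁) (graphWith id (take j l))
  positions<j = All-proj₁-graphWith id (take j l) λ i< → <-≤-trans i< (length-take-≤ j l)
  positions≥j : All ((j ≤_) ∘ proj₁) (graphWith (j +_) (drop j l))
  positions≥j = All-proj₁-graphWith (j +_) (drop j l) λ {i} _ → m≤m+n j i
  ∈-take : ∀ {m} → m ∈ upTo j → m ∈ take j l
  ∈-take m∈ =
    pigeonhole (take j l) (Unique.take⁺ j u) fixes (trans (length-take j l) (m≤n⇒m⊓n≡m j≤l)) (∈-upTo⁻ m∈)
  hit : ∀ {m} → m ∈ upTo j →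
    Any (λ p → proj₁ p < j × proj₂ p ≡ m) (graphWith id (take j l) ++ graphWith (j +_) (drop j l))
  hit {m} m∈
    with p , p∈ , refl ← ∈-map⁻ proj₂ (subst (m ∈_) (sym (map-proj₂-graphWith id (take j l))) (∈-take m∈)) =
    Any.++⁺ˡ (lose p∈ (All.lookup positions<j p∈ , refl))

FixesPrefix⇔FixesPrefixℕ : ∀ {n} (σ : List (Fin n)) j → Unique (map toℕ σ) → j ≤ length σ →
  FixesPrefix σ j ⇔ FixesPrefixℕ (map toℕ σ) j
FixesPrefix⇔FixesPrefixℕ σ j u j≤σ = mk⇔
  (FixesPrefixOfGraph⇒FixesPrefixℕ (map toℕ σ) j ∘ subst (λ gr → FixesPrefixOfGraph gr j) graph≡)
  (subst (λ gr → FixesPrefixOfGraph gr j) (sym graph≡)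
   ∘ FixesPrefixℕ⇒FixesPrefixOfGraph (map toℕ σ) j u (subst (j ≤_) (sym (length-map toℕ σ)) j≤σ))
  where
  graph≡ : graph σ ≡ graphWith id (map toℕ σ)
  graph≡ = cong (λ k → zip (upTo k) (map toℕ σ)) (sym (length-map toℕ σ))

Connectedℕ : (ℕ → Bool) → List ℕ → Set
Connectedℕ S l = All (λ j → 1 ≤ j → S j ≡ true → ¬ FixesPrefixℕ l j) (upTo (length l))

connectedℕ? : ∀ S l → Dec (Connectedℕ S l)
connectedℕ? S l = All.all? (λ j → (1 ≤? j) →-dec ((S j ≟ᵇ true) →-dec ¬? (fixesPrefixℕ? l j))) (upTo (length l))

Connected⇔Connectedℕ : ∀ {n} S {σ : List (Fin n)} → σ ∈ perms n → Connected S σ ⇔ Connectedℕ S (map toℕ σ)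
Connected⇔Connectedℕ {n} S {σ} σ∈ with len , _ , u ← perm⇒IsPermutation σ∈ = mk⇔
  (λ con → All.tabulate λ {j} j∈ 1≤j Sj fix → let j<n = subst (j <_) len (∈-upTo⁻ j∈) in
     All.lookup con (∈-upTo⁺ j<n) 1≤j Sj (Equivalence.from (FixesPrefix⇔ j<n) fix))
  (λ con → All.tabulate λ {j} j∈ 1≤j Sj fix → let j<n = ∈-upTo⁻ j∈ in
     All.lookup con (∈-upTo⁺ (subst (j <_) (sym len) j<n)) 1≤j Sj (Equivalence.to (FixesPrefix⇔ j<n) fix))
  where
  FixesPrefix⇔ : ∀ {j} → j < n → FixesPrefix σ j ⇔ FixesPrefixℕ (map toℕ σ) j
  FixesPrefix⇔ {j} j<n =
    FixesPrefix⇔FixesPrefixℕ σ j u (subst (j ≤_) (trans (sym len) (length-map toℕ σ)) (<⇒≤ j<n))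

c≡length-filter-connectedℕ : ∀ n S → c n S ≡ length (filter (connectedℕ? S) (permutations n))
c≡length-filter-connectedℕ n S =
  length-filter-map (connected? S) (connectedℕ? S) (map toℕ) (perms n) (Connected⇔Connectedℕ S)

take-length-++ : (xs ys : List A) → take (length xs) (xs ++ ys) ≡ xs
take-length-++ [] ys = refl
take-length-++ (x ∷ xs) ys = cong (x ∷_) (take-length-++ xs ys)

take-length+-++ : (xs ys : List A) (k : ℕ) → take (length xs + k) (xs ++ ys) ≡ xs ++ take k ys
take-length+-++ [] ys k = refl
take-length+-++ (x ∷ xs) ys k = cong (x ∷_) (take-length+-++ xs ys k)

FixesPrefixℕ-++ : ∀ {i} (α γ : List ℕ) → length α ≡ i → All (_< i) α → FixesPrefixℕ (α ++ γ) i
FixesPrefixℕ-++ α γ refl α<i = subst (All _) (sym (take-length-++ α γ)) α<i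

FixesPrefixℕ-++-shift : ∀ {i} (α β : List ℕ) k → length α ≡ i → All (_< i) α →
  FixesPrefixℕ (α ++ map (i +_) β) (i + k) ⇔ FixesPrefixℕ β k
FixesPrefixℕ-++-shift {i} α β k refl α<i = mk⇔
  (λ fix → All.map (+-cancelˡ-< i _ _)
             (All.map⁻ (subst (All _) (take-map k β) (All.++⁻ʳ α (subst (All _) take≡ fix)))))
  (λ fix → subst (All _) (sym take≡) (All.++⁺ (All.map (λ a<i → <-≤-trans a<i (m≤m+n i k)) α<i)
                                             (subst (All _) (sym (take-map k β)) (All.map⁺ (All.map (+-monoʳ-< i) fix)))))
  where
  take≡ : take (i + k) (α ++ map (i +_) β) ≡ α ++ take k (map (i +_) β)
  take≡ = take-length+-++ α (map (i +_) β) k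

LastFixedPrefix : (ℕ → Bool) → ℕ → List ℕ → Set
LastFixedPrefix S i l = FixesPrefixℕ l i × All (λ j → i < j → S j ≡ true → ¬ FixesPrefixℕ l j) (upTo (length l))

lastFixedPrefix? : ∀ S i l → Dec (LastFixedPrefix S i l)
lastFixedPrefix? S i l =
  fixesPrefixℕ? l i ×-dec All.all? (λ j → (i <? j) →-dec ((S j ≟ᵇ true) →-dec ¬? (fixesPrefixℕ? l j))) (upTo (length l))

LastFixedPrefix-++⇔Connectedℕ : ∀ S {i} (α β : List ℕ) → length α ≡ i → All (_< i) α →
  LastFixedPrefix S i (α ++ map (i +_) β) ⇔ Connectedℕ (shift i S) β
LastFixedPrefix-++⇔Connectedℕ S {i} α β len-α α<i = mk⇔
  (λ (_ , noneAbove) → All.tabulate λ {k} k∈ 1≤k Sk+i fixβ →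
     All.lookup noneAbove (∈-upTo⁺ (subst (i + k <_) (sym len-l) (+-monoʳ-< i (∈-upTo⁻ k∈))))
       (m<m+n i 1≤k) (subst (λ j → S j ≡ true) (+-comm k i) Sk+i) (Equivalence.from (shifted k) fixβ))
  (λ con → FixesPrefixℕ-++ α _ len-α α<i , All.tabulate (noneAbove con ∘ ∈-upTo⁻))
  where
  l : List ℕ
  l = α ++ map (i +_) β
  len-l : length l ≡ i + length β
  len-l = trans (length-++ α) (cong₂ _+_ len-α (length-map _ β))
  shifted : ∀ k → FixesPrefixℕ l (i + k) ⇔ FixesPrefixℕ β k
  shifted k = FixesPrefixℕ-++-shift α β k len-α α<i
  noneAbove : Connectedℕ (shift i S) β → ∀ {j} → j < length l → i < j → S j ≡ true → ¬ FixesPrefixℕ l j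
  noneAbove con j<l i<j Sj fix with k , refl ← m≤n⇒∃[o]m+o≡n (<⇒≤ i<j) =
    All.lookup con (∈-upTo⁺ (+-cancelˡ-< i _ _ (subst (i + k <_) len-l j<l)))
      (+-cancelˡ-< i 0 k (subst (_< i + k) (sym (+-identityʳ i)) i<j))
      (subst (λ j → S j ≡ true) (+-comm i k) Sj) (Equivalence.to (shifted k) fix)

IsPermutation-++-shift : ∀ {n i α β} → i ≤ n → IsPermutation i α → IsPermutation (n ∸ i) β →
  IsPermutation n (α ++ map (i +_) β)
IsPermutation-++-shift {n} {i} {α} {β} i≤n (len-α , α<i , uα) (len-β , β<n∸i , uβ) =
  length≡ ,
  All.++⁺ (All.map (λ a<i → <-≤-trans a<i i≤n) α<i) (All.map⁺ (All.map shift-< β<n∸i)) ,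
  Unique.++⁺ uα (Unique.map⁺ (+-cancelˡ-≡ i _ _) uβ) disjoint
  where
  length≡ : length (α ++ map (i +_) β) ≡ n
  length≡ = trans (length-++ α) (trans (cong₂ _+_ len-α (trans (length-map _ β) len-β)) (m+[n∸m]≡n i≤n))
  shift-< : ∀ {b} → b < n ∸ i → i + b < n
  shift-< b< = subst (i + _ <_) (m+[n∸m]≡n i≤n) (+-monoʳ-< i b<)
  disjoint : Disjoint α (map (i +_) β)
  disjoint (a∈α , a∈iβ) with b , _ , refl ← ∈-map⁻ (i +_) a∈iβ = <⇒≱ (All.lookup α<i a∈α) (m≤m+n i b)

module _ {n i : ℕ} {l : List ℕ} (i≤n : i ≤ n) (perm : IsPermutation n l) (fixes : FixesPrefixℕ l i) where

  private
    len : length l ≡ n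
    len = proj₁ perm
    l<n : All (_< n) l
    l<n = proj₁ (proj₂ perm)
    u : Unique l
    u = proj₂ (proj₂ perm)
    i≤l : i ≤ length l
    i≤l = subst (i ≤_) (sym len) i≤n

  IsPermutation-take : IsPermutation i (take i l)
  IsPermutation-take = trans (length-take i l) (m≤n⇒m⊓n≡m i≤l) , fixes , Unique.take⁺ i u

  drop-≥ : All (i ≤_) (drop i l)
  drop-≥ = All.tabulate λ {x} x∈drop → decidable-stable (i ≤? x) λ i≰x →
    Unique-++⇒Disjoint (take i l) (subst Unique (sym (take++drop≡id i l)) u)
      (pigeonhole (take i l) (Unique.take⁺ i u) fixes (proj₁ IsPermutation-take) (≰⇒> i≰x) , x∈drop)

  IsPermutation-drop : IsPermutation (n ∸ i) (map (_∸ i) (drop i l))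
  IsPermutation-drop =
    trans (length-map _ (drop i l)) (trans (length-drop i l) (cong (_∸ i) len)) ,
    All.map⁺ (All.zipWith (λ (x<n , i≤x) → ∸-monoˡ-< x<n i≤x) (All.drop⁺ i l<n , drop-≥)) ,
    Unique-map⁺ (λ x∈ y∈ → ∸-cancelʳ-≡ (All.lookup drop-≥ x∈) (All.lookup drop-≥ y∈)) (Unique.drop⁺ i u)

  take-++-shift-drop : take i l ++ map (i +_) (map (_∸ i) (drop i l)) ≡ l
  take-++-shift-drop = begin
    take i l ++ map (i +_) (map (_∸ i) (drop i l))
      ≡⟨ cong (take i l ++_) (map-∘ (drop i l)) ⟨
    take i l ++ map (λ x → i + (x ∸ i)) (drop i l)
      ≡⟨ cong (take i l ++_) (map-id-local (All.map m+[n∸m]≡n drop-≥)) ⟩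
    take i l ++ drop i l
      ≡⟨ take++drop≡id i l ⟩
    l ∎
    where open ≡-Reasoning

length-lastFixedPrefix : ∀ S {n i} → i ≤ n →
  length (filter (lastFixedPrefix? S i) (permutations n)) ≡
  i ! * length (filter (connectedℕ? (shift i S)) (permutations (n ∸ i)))
length-lastFixedPrefix S {n} {i} i≤n = begin
  length (filter (lastFixedPrefix? S i) (permutations n))
    ≡⟨ length-≡-by-bijection glue
         (Unique.cartesianProduct⁺ (permutations-unique i) (Unique.filter⁺ _ (permutations-unique (n ∸ i))))
         (Unique.filter⁺ _ (permutations-unique n)) glue-injective glue-∈ glue-surjective ⟨
  length (cartesianProduct (permutations i) connectedTails)
    ≡⟨ length-cartesianProduct (permutations i) connectedTails ⟩
  length (permutations i) * length connectedTails
    ≡⟨ cong (_* length connectedTails) (length-permutations i) ⟩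
  i ! * length connectedTails ∎
  where
  open ≡-Reasoning
  connectedTails : List (List ℕ)
  connectedTails = filter (connectedℕ? (shift i S)) (permutations (n ∸ i))
  pairs : List (List ℕ × List ℕ)
  pairs = cartesianProduct (permutations i) connectedTails
  glue : List ℕ × List ℕ → List ℕ
  glue (α , β) = α ++ map (i +_) β

  glue-injective : InjectiveOn glue pairs
  glue-injective {α , β} {α′ , β′} p∈ p′∈ eq
    with α∈ , _ ← ∈-cartesianProduct⁻ (permutations i) connectedTails p∈
    with α′∈ , _ ← ∈-cartesianProduct⁻ (permutations i) connectedTails p′∈
    with len-α , _ ← ∈-permutations⁻ α∈
    with len-α′ , _ ← ∈-permutations⁻ α′∈
    with refl ← trans (sym (take-length-++ α _)) (trans (cong₂ take (trans len-α (sym len-α′)) eq) (take-length-++ α′ _)) =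
    cong (α ,_) (map-injective (+-cancelˡ-≡ i _ _) (++-cancelˡ α _ _ eq))

  glue-∈ : ∀ {p} → p ∈ pairs → glue p ∈ filter (lastFixedPrefix? S i) (permutations n)
  glue-∈ {α , β} p∈
    with α∈ , β∈′ ← ∈-cartesianProduct⁻ (permutations i) connectedTails p∈
    with β∈ , con ← ∈-filter⁻ (connectedℕ? (shift i S)) β∈′
    with permα@(len-α , α<i , _) ← ∈-permutations⁻ α∈ =
    ∈-filter⁺ (lastFixedPrefix? S i)
      (∈-permutations⁺ (IsPermutation-++-shift i≤n permα (∈-permutations⁻ β∈)))
      (Equivalence.from (LastFixedPrefix-++⇔Connectedℕ S α β len-α α<i) con)

  glue-surjective : ∀ {l} → l ∈ filter (lastFixedPrefix? S i) (permutations n) →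
    ∃ λ p → p ∈ pairs × glue p ≡ l
  glue-surjective {l} l∈
    with l∈′ , last@(fixes , _) ← ∈-filter⁻ (lastFixedPrefix? S i) l∈ =
    (α , β) ,
    ∈-cartesianProduct⁺ (∈-permutations⁺ permα) (∈-filter⁺ (connectedℕ? (shift i S)) (∈-permutations⁺ permβ) con) ,
    take-++-shift-drop i≤n perm fixes
    where
    perm : IsPermutation n l
    perm = ∈-permutations⁻ l∈′
    α β : List ℕ
    α = take i l
    β = map (_∸ i) (drop i l)
    permα : IsPermutation i α
    permα = IsPermutation-take i≤n perm fixes
    permβ : IsPermutation (n ∸ i) β
    permβ = IsPermutation-drop i≤n perm fixes
    con : Connectedℕ (shift i S) β
    con = Equivalence.to (LastFixedPrefix-++⇔Connectedℕ S α β (proj₁ permα) (proj₁ (proj₂ permα)))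
            (subst (LastFixedPrefix S i) (sym (take-++-shift-drop i≤n perm fixes)) last)

InS : (ℕ → Bool) → ℕ → Set
InS S i = 1 ≤ i × S i ≡ true

inS? : ∀ S i → Dec (InS S i)
inS? S i = (1 ≤? i) ×-dec (S i ≟ᵇ true)

sizes : ℕ → (ℕ → Bool) → List ℕ
sizes n S = filter (inS? S) (upTo n)

∈-sizes⁻ : ∀ {n S i} → i ∈ sizes n S → i < n × InS S i
∈-sizes⁻ {S = S} i∈ with i∈upTo , S∋i ← ∈-filter⁻ (inS? S) i∈ = ∈-upTo⁻ i∈upTo , S∋i

¬Connectedℕ⇒FixesPrefixℕ : ∀ S l → ¬ Connectedℕ S l →
  ∃ λ j → j < length l × InS S j × FixesPrefixℕ l j
¬Connectedℕ⇒FixesPrefixℕ S l ¬con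
  with j , j∈ , ¬noFix ← find (All.¬All⇒Any¬ (λ j → (1 ≤? j) →-dec ((S j ≟ᵇ true) →-dec ¬? (fixesPrefixℕ? l j)))
                                              _ ¬con) =
  j , ∈-upTo⁻ j∈ ,
  (decidable-stable (1 ≤? j) (λ 1≰j → ¬noFix λ 1≤j → ⊥-elim (1≰j 1≤j)) ,
   decidable-stable (S j ≟ᵇ true) (λ Sj≢true → ¬noFix λ _ Sj → ⊥-elim (Sj≢true Sj))) ,
  decidable-stable (fixesPrefixℕ? l j) (λ ¬fix → ¬noFix λ _ _ → ¬fix)

-- A non-S-connected permutation is counted in exactly one summand: the one
-- for the largest size in S of a prefix it fixes.
length-filter-¬connectedℕ : ∀ n S →
  sum (map (λ i → length (filter (lastFixedPrefix? S i) (permutations n))) (sizes n S)) ≡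
  length (filter (¬? ∘ connectedℕ? S) (permutations n))
length-filter-¬connectedℕ n S =
  sum-length-filter (lastFixedPrefix? S) (¬? ∘ connectedℕ? S) (Unique.filter⁺ _ (Unique.upTo⁺ n)) (permutations n)
    witness sound unique
  where
  witness : ∀ {l} → l ∈ permutations n → ¬ Connectedℕ S l → ∃ λ i → i ∈ sizes n S × LastFixedPrefix S i l
  witness {l} l∈ ¬con
    with len , _ ← ∈-permutations⁻ l∈
    with j , j<l , Q[j] ← ¬Connectedℕ⇒FixesPrefixℕ S l ¬con
    with i , i<l , ((1≤i , Si) , fix) , noneAbove ←
           largest-below (λ j → inS? S j ×-dec fixesPrefixℕ? l j) j<l Q[j] =
    i , ∈-filter⁺ _ (∈-upTo⁺ (subst (i <_) len i<l)) (1≤i , Si) ,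
    fix ,
    All.tabulate λ {k} k∈ i<k Sk fixk → noneAbove i<k (∈-upTo⁻ k∈) ((≤-trans 1≤i (<⇒≤ i<k) , Sk) , fixk)

  sound : ∀ {l i} → l ∈ permutations n → i ∈ sizes n S → LastFixedPrefix S i l → ¬ Connectedℕ S l
  sound {l} {i} l∈ i∈ (fix , _) con
    with len , _ ← ∈-permutations⁻ l∈
    with i<n , 1≤i , Si ← ∈-sizes⁻ i∈ = All.lookup con (∈-upTo⁺ (subst (i <_) (sym len) i<n)) 1≤i Si fix

  unique : ∀ {l i j} → l ∈ permutations n → i ∈ sizes n S → j ∈ sizes n S →
    LastFixedPrefix S i l → LastFixedPrefix S j l → i ≡ j
  unique {l} {i} {j} l∈ i∈ j∈ (fixi , aboveI) (fixj , aboveJ)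
    with len , _ ← ∈-permutations⁻ l∈
    with i<n , _ , Si ← ∈-sizes⁻ i∈
    with j<n , _ , Sj ← ∈-sizes⁻ j∈
    with <-cmp i j
  ... | tri< i<j _ _ = ⊥-elim (All.lookup aboveI (∈-upTo⁺ (subst (j <_) (sym len) j<n)) i<j Sj fixj)
  ... | tri≈ _ i≡j _ = i≡j
  ... | tri> _ _ j<i = ⊥-elim (All.lookup aboveJ (∈-upTo⁺ (subst (i <_) (sym len) i<n)) j<i Si fixi)

mainTheorem1 : (n : ℕ) → 1 ≤ n → (S : ℕ → Bool) →
    (∀ j → S j ≡ true → 1 ≤ j) → (∀ j → S j ≡ true → j < n) →
    c n S + sumOver n S (λ i → (i !) * c (n ∸ i) (shift i S)) ≡ n !
mainTheorem1 n _ S _ _ = begin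
  c n S + sumOver n S (λ i → i ! * c (n ∸ i) (shift i S))
    ≡⟨ cong₂ _+_ (c≡length-filter-connectedℕ n S) (cong sum (map-cong-local (All.tabulate summand≡))) ⟩
  length (filter (connectedℕ? S) Pₙ) + sum (map (λ i → length (filter (lastFixedPrefix? S i) Pₙ)) (sizes n S))
    ≡⟨ cong (length (filter (connectedℕ? S) Pₙ) +_) (length-filter-¬connectedℕ n S) ⟩
  length (filter (connectedℕ? S) Pₙ) + length (filter (¬? ∘ connectedℕ? S) Pₙ)
    ≡⟨ length-filter-+-length-filter-¬ (connectedℕ? S) Pₙ ⟩
  length Pₙ
    ≡⟨ length-permutations n ⟩
  n ! ∎
  where
  open ≡-Reasoning
  Pₙ : List (List ℕ)
  Pₙ = permutations n
  summand≡ : ∀ {i} → i ∈ sizes n S → i ! * c (n ∸ i) (shift i S) ≡ length (filter (lastFixedPrefix? S i) Pₙ)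
  summand≡ {i} i∈ = begin
    i ! * c (n ∸ i) (shift i S)
      ≡⟨ cong (i ! *_) (c≡length-filter-connectedℕ (n ∸ i) (shift i S)) ⟩
    i ! * length (filter (connectedℕ? (shift i S)) (permutations (n ∸ i)))
      ≡⟨ length-lastFixedPrefix S (<⇒≤ (proj₁ (∈-sizes⁻ i∈))) ⟨
    length (filter (lastFixedPrefix? S i) Pₙ) ∎
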